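{- Let $\mu$ be a doubling measure on $\mathbb Z$ and set $a_j=\mu(j)$. If there exist integers $j_1<j_2<j_3$ such that $a_{j_2}<\min\{a_{j_1},a_{j_3}\}$, then $C^0_\mu>3$.
   Context: $\mathbb Z$ is viewed as the infinite path graph with edges $\{j,j+1\}$, with distance $d(i,j)=|i-j|$. A measure $\mu$ is a weight function $\mu:\mathbb Z\to(0,\infty)$, $\mu(A)=\sum_{v\in A}\mu(v)$; $B(x,r)=\{y:d(x,y)\le r\}$. $\mu$ is doubling if $C_\mu=\sup\{\mu(B(x,2k+1))/\mu(B(x,k)):x\in\mathbb Z,k\in\{0,1,\dots\}\}<\infty$, and $C^0_\mu=\sup_x\mu(B(x,1))/\mu(x)$. -}

module Defs where

open import Level using (Level; _⊔_; suc)
open import Data.Nat as ℕ using (ℕ)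
open import Data.Integer as ℤ using (ℤ; +_)
open import Data.Product using (Σ; ∃; ∃-syntax; _×_)
open import Data.Sum using (_⊎_)
open import Relation.Nullary using (¬_)
open import Relation.Binary.Structures using (IsStrictTotalOrder)
open import Algebra.Bundles using (CommutativeRing)

-- An ordered field (the real numbers ℝ are one; the standard library has no reals).
record OrderedField (c ℓ₁ ℓ₂ : Level) : Set (Level.suc (c ⊔ ℓ₁ ⊔ ℓ₂)) where
  field
    commutativeRing′ : CommutativeRing c ℓ₁
  open CommutativeRing commutativeRing′ public
  field
    _<_                 : Carrier → Carrier → Set ℓ₂
    isStrictTotalOrder  : IsStrictTotalOrder _≈_ _<_
    +-mono-<            : ∀ {x y} z → x < y → (x + z) < (y + z)
    *-pos               : ∀ {x y} → 0# < x → 0# < y → 0# < (x * y)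
    inverse             : ∀ x → ¬ (x ≈ 0#) → ∃[ y ] (x * y ≈ 1#)

  _≤_ : Carrier → Carrier → Set (ℓ₁ ⊔ ℓ₂)
  x ≤ y = (x < y) ⊎ (x ≈ y)

  three : Carrier
  three = 1# + 1# + 1#

module _ {c ℓ₁ ℓ₂} (F : OrderedField c ℓ₁ ℓ₂) where
  open OrderedField F

  IsMeasure : (ℤ → Carrier) → Set ℓ₂
  IsMeasure μ = ∀ v → 0# < μ v

  sumFrom : (ℤ → Carrier) → ℤ → ℕ → Carrier
  sumFrom μ a ℕ.zero    = 0#
  sumFrom μ a (ℕ.suc n) = μ a + sumFrom μ (a ℤ.+ + 1) n

  ballMeasure : (ℤ → Carrier) → ℤ → ℕ → Carrier
  ballMeasure μ x r = sumFrom μ (x ℤ.- + r) (ℕ.suc (2 ℕ.* r))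

  IsDoubling : (ℤ → Carrier) → Set (c ⊔ ℓ₁ ⊔ ℓ₂)
  IsDoubling μ = ∃[ C ] (∀ (x : ℤ) (k : ℕ) →
    ballMeasure μ x (ℕ.suc (2 ℕ.* k)) ≤ (C * ballMeasure μ x k))

  -- C⁰_μ > 3, i.e. some ratio μ(B(x,1))/μ(x) exceeds 3
  C⁰>3 : (ℤ → Carrier) → Set ℓ₂
  C⁰>3 μ = ∃[ x ] ((three * μ x) < ballMeasure μ x 1)

-- A strict dip μ j₂ < min (μ j₁, μ j₃) forces a valley: a point x with μ x < μ (x - 1) and
-- μ x ≤ μ (x + 1).  Some strict descent before j₂ lands at or below μ j₂, since otherwise μ
-- would be non-decreasing on [j₁, j₂].  Strict descents starting there cannot continue all
-- the way to j₃, so one of them is followed by a non-descent.  At that valley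
-- μ (B(x,1)) = μ (x - 1) + μ x + μ (x + 1) > 3 μ x.
module Submission where

open import Defs
open import Level using (Level)

open import Data.Nat as ℕ using (ℕ; zero; suc; _∸_)
import Data.Nat.Properties as ℕ
open import Data.Integer as ℤ using (ℤ; +_; 1ℤ; ∣_∣)
open import Data.Integer.Properties as ℤ using (pos-+; 0≤i⇒+∣i∣≡i; i≤j⇒0≤j-i; drop‿+<+)
open import Data.Integer.Tactic.RingSolver using (solve-∀)
open import Data.Product using (_×_; ∃; ∃-syntax; _,_)
open import Data.Sum using (inj₁; inj₂)
open import Data.Empty using (⊥-elim)
open import Relation.Nullary using (¬_; yes; no)
open import Relation.Binary.Bundles using (StrictTotalOrder)
open import Relation.Binary.Structures using (IsStrictTotalOrder)
open import Relation.Binary.Definitions using (tri<; tri≈; tri>)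
open import Relation.Binary.PropositionalEquality as ≡ using (_≡_; cong; subst; subst₂)

i+1-1≡i : ∀ i → i ℤ.+ 1ℤ ℤ.- 1ℤ ≡ i
i+1-1≡i = solve-∀

i+[1+n]≡i+n+1 : ∀ i n → i ℤ.+ + suc n ≡ i ℤ.+ + n ℤ.+ 1ℤ
i+[1+n]≡i+n+1 i n = ≡.trans (cong (ℤ._+_ i) (pos-+ 1 n)) (reassoc i (+ n))
  where
  reassoc : ∀ i k → i ℤ.+ (1ℤ ℤ.+ k) ≡ i ℤ.+ k ℤ.+ 1ℤ
  reassoc = solve-∀

i+∣j-i∣≡j : ∀ {i j} → i ℤ.≤ j → i ℤ.+ + ∣ j ℤ.- i ∣ ≡ j
i+∣j-i∣≡j {i} {j} i≤j = ≡.trans (cong (ℤ._+_ i) (0≤i⇒+∣i∣≡i (i≤j⇒0≤j-i i≤j))) (cancel i j)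
  where
  cancel : ∀ i j → i ℤ.+ (j ℤ.- i) ≡ j
  cancel = solve-∀

∣j-i∣<∣k-i∣ : ∀ {i j k} → i ℤ.≤ j → j ℤ.< k → ∣ j ℤ.- i ∣ ℕ.< ∣ k ℤ.- i ∣
∣j-i∣<∣k-i∣ {i} i≤j j<k = drop‿+<+ (subst₂ ℤ._<_
  (≡.sym (0≤i⇒+∣i∣≡i (i≤j⇒0≤j-i i≤j)))
  (≡.sym (0≤i⇒+∣i∣≡i (i≤j⇒0≤j-i (ℤ.≤-trans i≤j (ℤ.<⇒≤ j<k)))))
  (ℤ.+-monoˡ-< (ℤ.- i) j<k))

module Valleys {a ℓ₁ ℓ₂} (O : StrictTotalOrder a ℓ₁ ℓ₂) where
  open StrictTotalOrder O
  open import Relation.Binary.Construct.StrictToNonStrict _≈_ _<_ as NonStrict using (_≤_; <⇒≤)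

  ≤-trans : ∀ {x y z} → x ≤ y → y ≤ z → x ≤ z
  ≤-trans = NonStrict.trans isEquivalence <-resp-≈ trans

  ≤-<-trans : ∀ {x y z} → x ≤ y → y < z → x < z
  ≤-<-trans = NonStrict.≤-<-trans Eq.sym trans <-respˡ-≈

  ≮⇒≥ : ∀ {x y} → ¬ (x < y) → y ≤ x
  ≮⇒≥ {x} {y} x≮y with compare x y
  ... | tri< x<y _   _   = ⊥-elim (x≮y x<y)
  ... | tri≈ _   x≈y _   = NonStrict.reflexive (Eq.sym x≈y)
  ... | tri> _   _   y<x = <⇒≤ y<x

  module _ (f : ℕ → Carrier) where

    Descent : ℕ → Set ℓ₂
    Descent m = f (suc m) < f m

    Valley : ℕ → Set _
    Valley m = Descent m × f (suc m) ≤ f (suc (suc m))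

    descent-below : ∀ {B} z → B < f 0 → f z ≤ B →
                    ∃[ m ] Descent m × f (suc m) ≤ B × m ℕ.< z
    descent-below zero    B<f₀ f₀≤B = ⊥-elim (irrefl Eq.refl (≤-<-trans f₀≤B B<f₀))
    descent-below (suc z) B<f₀ f≤B with f (suc z) <? f z
    ... | yes descent = z , descent , f≤B , ℕ.n<1+n z
    ... | no ¬descent =
      let m , descent , below , m<z = descent-below z B<f₀ (≤-trans (≮⇒≥ ¬descent) f≤B)
      in  m , descent , below , ℕ.m<n⇒m<1+n m<z

    valley-after-descent : ∀ k m → Descent m → f (suc m) < f (k ℕ.+ suc m) → ∃ Valley
    valley-after-descent k m descent rise with f (suc (suc m)) <? f (suc m)
    ... | no ¬descent = m , descent , ≮⇒≥ ¬descent
    valley-after-descent zero    m _ rise | yes _ = ⊥-elim (irrefl Eq.refl rise)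
    valley-after-descent (suc k) m _ rise | yes descent =
      valley-after-descent k (suc m) descent
        (subst (λ i → f (suc (suc m)) < f i) (≡.sym (ℕ.+-suc k (suc m))) (trans descent rise))

    valley-between : ∀ {q r} → q ℕ.< r → f q < f 0 → f q < f r → ∃ Valley
    valley-between {q} {r} q<r dip rise
      with descent-below q dip (NonStrict.reflexive Eq.refl)
    ... | m , descent , below , m<q =
      valley-after-descent (r ∸ suc m) m descent
        (subst (λ i → f (suc m) < f i) (≡.sym (ℕ.m∸n+n≡m (ℕ.<-trans m<q q<r)))
               (≤-<-trans below rise))

module OrderedFieldProperties {c ℓ₁ ℓ₂} (F : OrderedField c ℓ₁ ℓ₂) where
  open OrderedField F
  open IsStrictTotalOrder isStrictTotalOrder using (<-respˡ-≈; <-respʳ-≈) renaming (trans to <-trans)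
  open import Relation.Binary.Reasoning.Setoid setoid

  strictTotalOrder : StrictTotalOrder c ℓ₁ ℓ₂
  strictTotalOrder = record { isStrictTotalOrder = isStrictTotalOrder }

  open Valleys strictTotalOrder using (Valley; valley-between)

  +-monoʳ-< : ∀ z {x y} → x < y → (z + x) < (z + y)
  +-monoʳ-< z {x} {y} x<y = <-respˡ-≈ (+-comm x z) (<-respʳ-≈ (+-comm y z) (+-mono-< z x<y))

  +-mono-<-≤ : ∀ {x y u v} → x < y → u ≤ v → (x + u) < (y + v)
  +-mono-<-≤ {x} {y} {u} x<y (inj₁ u<v) = <-trans (+-mono-< u x<y) (+-monoʳ-< y u<v)
  +-mono-<-≤ {x} {y} {u} x<y (inj₂ u≈v) = <-respʳ-≈ (+-congˡ u≈v) (+-mono-< u x<y)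

  +-monoʳ-≤ : ∀ z {x y} → x ≤ y → (z + x) ≤ (z + y)
  +-monoʳ-≤ z (inj₁ x<y) = inj₁ (+-monoʳ-< z x<y)
  +-monoʳ-≤ z (inj₂ x≈y) = inj₂ (+-congˡ x≈y)

  three*x≈x+[x+x] : ∀ x → three * x ≈ x + (x + x)
  three*x≈x+[x+x] x = begin
    (1# + 1# + 1#) * x      ≈⟨ distribʳ x (1# + 1#) 1# ⟩
    (1# + 1#) * x + 1# * x  ≈⟨ +-cong (distribʳ x 1# 1#) (*-identityˡ x) ⟩
    1# * x + 1# * x + x     ≈⟨ +-congʳ (+-cong (*-identityˡ x) (*-identityˡ x)) ⟩
    x + x + x               ≈⟨ +-comm (x + x) x ⟩
    x + (x + x)             ∎

  three*-<-valley : ∀ {a b c} → b < a → b ≤ c → (three * b) < (a + (b + c))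
  three*-<-valley {a} {b} b<a b≤c =
    <-respˡ-≈ (sym (three*x≈x+[x+x] b)) (+-mono-<-≤ b<a (+-monoʳ-≤ b b≤c))

  module _ (μ : ℤ → Carrier) where

    ballMeasure-1 : ∀ x → ballMeasure F μ (x ℤ.+ 1ℤ) 1 ≡ μ x + (μ (x ℤ.+ 1ℤ) + (μ (x ℤ.+ 1ℤ ℤ.+ 1ℤ) + 0#))
    ballMeasure-1 x rewrite i+1-1≡i x = ≡.refl

    C⁰>3-at-valley : ∀ x → μ (x ℤ.+ 1ℤ) < μ x → μ (x ℤ.+ 1ℤ) ≤ μ (x ℤ.+ 1ℤ ℤ.+ 1ℤ) → C⁰>3 F μ
    C⁰>3-at-valley x drop rise =
      x ℤ.+ 1ℤ , subst ((three * μ (x ℤ.+ 1ℤ)) <_) (≡.sym (ballMeasure-1 x))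
                       (<-respʳ-≈ (+-congˡ (+-congˡ (sym (+-identityʳ _)))) (three*-<-valley drop rise))

    valley⇒C⁰>3 : ∀ j {m} → Valley (λ n → μ (j ℤ.+ + n)) m → C⁰>3 F μ
    valley⇒C⁰>3 j {m} (drop , rise) = C⁰>3-at-valley (j ℤ.+ + m)
      (subst (λ i → μ i < μ (j ℤ.+ + m)) (i+[1+n]≡i+n+1 j m) drop)
      (subst₂ (λ i k → μ i ≤ μ k) (i+[1+n]≡i+n+1 j m)
        (≡.trans (i+[1+n]≡i+n+1 j (suc m)) (cong (ℤ._+ 1ℤ) (i+[1+n]≡i+n+1 j m))) rise)

    dip⇒C⁰>3 : ∀ {j₁ j₂ j₃} → j₁ ℤ.< j₂ → j₂ ℤ.< j₃ → μ j₂ < μ j₁ → μ j₂ < μ j₃ → C⁰>3 F μ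
    dip⇒C⁰>3 {j₁} {j₂} {j₃} j₁<j₂ j₂<j₃ dip rise
      with valley-between (λ n → μ (j₁ ℤ.+ + n)) (∣j-i∣<∣k-i∣ j₁≤j₂ j₂<j₃)
             (subst₂ (λ i k → μ i < μ k) (≡.sym (i+∣j-i∣≡j j₁≤j₂)) (≡.sym (ℤ.+-identityʳ j₁)) dip)
             (subst₂ (λ i k → μ i < μ k) (≡.sym (i+∣j-i∣≡j j₁≤j₂)) (≡.sym (i+∣j-i∣≡j j₁≤j₃)) rise)
      where
      j₁≤j₂ : j₁ ℤ.≤ j₂
      j₁≤j₂ = ℤ.<⇒≤ j₁<j₂
      j₁≤j₃ : j₁ ℤ.≤ j₃
      j₁≤j₃ = ℤ.<⇒≤ (ℤ.<-trans j₁<j₂ j₂<j₃)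
    ... | _ , valley = valley⇒C⁰>3 j₁ valley

open import Data.Integer using (_<_)

lemma4p4 : ∀ {c ℓ₁ ℓ₂ : Level} (F : OrderedField c ℓ₁ ℓ₂) (μ : ℤ → OrderedField.Carrier F) →
    IsMeasure F μ → IsDoubling F μ →
    (j₁ j₂ j₃ : ℤ) → j₁ < j₂ → j₂ < j₃ →
    OrderedField._<_ F (μ j₂) (μ j₁) → OrderedField._<_ F (μ j₂) (μ j₃) →
    C⁰>3 F μ
lemma4p4 F μ _ _ _ _ _ = OrderedFieldProperties.dip⇒C⁰>3 F μ
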